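{- There exists no compositional translation $T$ from Propositional Dependence Logic $\mathcal{D}$ into $\mathcal{L}_{\mathsf{D}}$ which is sound with respect to SD-models, i.e., such that for every SD-model $W$ and every formula $\varphi$ of $\mathcal{D}$ we have $W\Vdash\varphi$ if and only if $W\models T(\varphi)$.
   Context: Fix a countably infinite set $\mathit{PROP}$ of proposition symbols; assignments are maps $w:\mathit{PROP}\to\{0,1\}$; an SD-model is a (possibly empty) set $W$ of assignments. $\mathcal{D}$: formulae $\varphi::= p\mid\neg p\mid\mathsf{D}(p_1,\dots,p_k;q)\mid\neg\mathsf{D}(p_1,\dots,p_k;q)\mid(\varphi\vee\varphi)\mid(\varphi\wedge\varphi)$ with $p,q,p_i\in\mathit{PROP}$, $k\in\mathbb{N}$ ($\mathsf{C}q$ denotes the case $k=0$). Team semantics: $W\Vdash p$ iff $w(p)=1$ for all $w\in W$; $W\Vdash\neg p$ iff $w(p)=0$ for all $w\in W$; $W\Vdash\mathsf{D}(p_1,\dots,p_k;q)$ iff for all $u,v\in W$, if $u(p_i)=v(p_i)$ for all $i\le k$ then $u(q)=v(q)$; $W\Vdash\neg\mathsf{D}(p_1,\dots,p_k;q)$ iff $W=\emptyset$; $W\Vdash\varphi\wedge\psi$ iff $W\Vdash\varphi$ and $W\Vdash\psi$; $W\Vdash\varphi\vee\psi$ iff there are $U,V\subseteq W$ with $U\cup V=W$, $U\Vdash\varphi$, $V\Vdash\psi$. $\mathcal{L}_{\mathsf{D}}$: formulae $\varphi::=p\mid\neg\varphi\mid(\varphi\to\varphi)\mid\mathsf{D}(\varphi_1,\dots,\varphi_k;\psi)$,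 $k\in\mathbb{N}$; at $w\in W$: $W,w\models p$ iff $w(p)=1$; $\neg,\to$ classical; $W,w\models\mathsf{D}(\varphi_1,\dots,\varphi_k;\psi)$ iff all $u,v\in W$ agreeing on the truth of each $\varphi_i$ agree on the truth of $\psi$. $W\models\varphi$ means $W,w\models\varphi$ for all $w\in W$. Compositional translation: the base operators of $\mathcal{D}$ are $\neg$ (on atoms), $\mathsf{D}$ with each arity $k$, $\neg\mathsf{D}$ with each arity, $\wedge$ and $\vee$; those of $\mathcal{L}_{\mathsf{D}}$ are $\neg$, $\to$, and $\mathsf{D}$ with each arity. An operator term of $\mathcal{L}_{\mathsf{D}}$ is an expression $\psi(X_1,\dots,X_n)$ built from placeholder symbols $X_1,\dots,X_n$ by the base operators of $\mathcal{L}_{\mathsf{D}}$ (placeholders may occur several times). A map $T$ from formulae of $\mathcal{D}$ to formulae of $\mathcal{L}_{\mathsf{D}}$ is compositional if (i) for each base operator $c$ of $\mathcal{D}$ taking $n$ arguments there is an operator term $\psi_c(X_1,\dots,X_n)$ of $\mathcal{L}_{\mathsf{D}}$ such that $T(c(\varphi_1,\dots,\varphi_n))=\psi_c(T(\varphi_1),\dots,T(\varphi_n))$ whenever $c(\varphi_1,\dots,\varphi_n)$ is a formula of $\mathcal{D}$ (the result of substituting $T(\varphi_i)$ for $X_i$), and (ii) for each $p\in\mathit{PROP}$, $T(p)$ contains no proposition symbol other than $p$. -}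

module Defs where

open import Data.Nat using (ℕ; suc)
open import Data.Bool using (Bool; true; false)
open import Data.Fin using (Fin)
open import Data.Vec using (Vec; lookup; map; _∷ʳ_)
open import Data.List using (List; []; _∷_)
open import Data.Product using (Σ; _×_; _,_)
open import Data.Sum using (_⊎_)
open import Relation.Nullary using (¬_)
open import Relation.Binary.PropositionalEquality using (_≡_)
open import Function.Bundles using (_⇔_)
open import Level using (Level) renaming (suc to lsuc; zero to lzero)

Assignment : Set
Assignment = ℕ → Bool

-- An SD-model: a (possibly empty, possibly infinite) set of assignments,
-- represented as a predicate on assignments.
SDModel : Set₁
SDModel = Assignment → Set

data DForm : Set where
  atom    : ℕ → DForm
  negAtom : ℕ → DForm
  dep     : (k : ℕ) → Vec ℕ k → ℕ → DForm
  negDep  : (k : ℕ) → Vec ℕ k → ℕ → DForm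
  _∨ᴰ_    : DForm → DForm → DForm
  _∧ᴰ_    : DForm → DForm → DForm

_⊩_ : SDModel → DForm → Set₁
W ⊩ atom p     = Level.Lift _ (∀ w → W w → w p ≡ true)
W ⊩ negAtom p  = Level.Lift _ (∀ w → W w → w p ≡ false)
W ⊩ dep k ps q = Level.Lift _ (∀ u v → W u → W v →
                   (∀ (i : Fin k) → u (lookup ps i) ≡ v (lookup ps i)) → u q ≡ v q)
W ⊩ negDep k ps q = Level.Lift _ (∀ w → ¬ W w)
W ⊩ (φ ∧ᴰ ψ)   = (W ⊩ φ) × (W ⊩ ψ)
W ⊩ (φ ∨ᴰ ψ)   = Σ SDModel λ U → Σ SDModel λ V →
                   (∀ w → U w → W w) × (∀ w → V w → W w) ×
                   (∀ w → W w → U w ⊎ V w) × (U ⊩ φ) × (V ⊩ ψ)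

data LForm : Set where
  var  : ℕ → LForm
  neg  : LForm → LForm
  imp  : LForm → LForm → LForm
  depL : List LForm → LForm → LForm

mutual
  Sat : SDModel → Assignment → LForm → Set
  Sat W w (var p)      = w p ≡ true
  Sat W w (neg φ)      = ¬ Sat W w φ
  Sat W w (imp φ ψ)    = Sat W w φ → Sat W w ψ
  Sat W w (depL φs ψ)  = ∀ u v → W u → W v → AgreeAll W u v φs →
                           (Sat W u ψ ⇔ Sat W v ψ)

  AgreeAll : SDModel → Assignment → Assignment → List LForm → Set
  AgreeAll W u v []       = Level.Lift _ Data.Unit.⊤
    where import Data.Unit
  AgreeAll W u v (φ ∷ φs) = (Sat W u φ ⇔ Sat W v φ) × AgreeAll W u v φs

_⊨_ : SDModel → LForm → Set
W ⊨ φ = ∀ w → W w → Sat W w φ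

data Occurs (q : ℕ) : LForm → Set where
  here  : Occurs q (var q)
  inNeg : ∀ {φ} → Occurs q φ → Occurs q (neg φ)
  inImpˡ : ∀ {φ ψ} → Occurs q φ → Occurs q (imp φ ψ)
  inImpʳ : ∀ {φ ψ} → Occurs q ψ → Occurs q (imp φ ψ)
  inDepArg : ∀ {φ φs ψ} → Occurs q φ → Occurs q (depL (φ ∷ φs) ψ)
  inDepArgs : ∀ {φ φs ψ} → Occurs q (depL φs ψ) → Occurs q (depL (φ ∷ φs) ψ)
  inDepHead : ∀ {φs ψ} → Occurs q ψ → Occurs q (depL φs ψ)

data OpTerm (n : ℕ) : Set where
  X     : Fin n → OpTerm n
  negO  : OpTerm n → OpTerm n
  impO  : OpTerm n → OpTerm n → OpTerm n
  depO  : List (OpTerm n) → OpTerm n → OpTerm n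

mutual
  inst : ∀ {n} → OpTerm n → (Fin n → LForm) → LForm
  inst (X i) σ        = σ i
  inst (negO t) σ     = neg (inst t σ)
  inst (impO t s) σ   = imp (inst t σ) (inst s σ)
  inst (depO ts t) σ  = depL (instList ts σ) (inst t σ)

  instList : ∀ {n} → List (OpTerm n) → (Fin n → LForm) → List LForm
  instList [] σ       = []
  instList (t ∷ ts) σ = inst t σ ∷ instList ts σ

env2 : LForm → LForm → Fin 2 → LForm
env2 a b Fin.zero = a
env2 a b (Fin.suc _) = b

envDep : (ℕ → LForm) → ∀ {k} → Vec ℕ k → ℕ → Fin (suc k) → LForm
envDep Tat ps q = lookup (map Tat ps ∷ʳ Tat q)

record Compositional (T : DForm → LForm) : Set where
  field
    ψneg    : OpTerm 1
    ψdep    : (k : ℕ) → OpTerm (suc k)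
    ψnegDep : (k : ℕ) → OpTerm (suc k)
    ψand    : OpTerm 2
    ψor     : OpTerm 2
    negEq    : ∀ p → T (negAtom p) ≡ inst ψneg (λ _ → T (atom p))
    depEq    : ∀ k (ps : Vec ℕ k) q →
                 T (dep k ps q) ≡ inst (ψdep k) (envDep (λ r → T (atom r)) ps q)
    negDepEq : ∀ k (ps : Vec ℕ k) q →
                 T (negDep k ps q) ≡ inst (ψnegDep k) (envDep (λ r → T (atom r)) ps q)
    andEq    : ∀ φ ψ → T (φ ∧ᴰ ψ) ≡ inst ψand (env2 (T φ) (T ψ))
    orEq     : ∀ φ ψ → T (φ ∨ᴰ ψ) ≡ inst ψor (env2 (T φ) (T ψ))
    atomEq   : ∀ p q → Occurs q (T (atom p)) → q ≡ p

Sound : (DForm → LForm) → Set₁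
Sound T = ∀ (W : SDModel) (φ : DForm) → (W ⊩ φ) ⇔ (W ⊨ T φ)

-- On the full model (all assignments), the truth of an instance ψ(φ₁,…,φₙ) of an operator
-- term at a world is determined by the truth values of the φᵢ there; consequently validity of
-- ψ(φ⃗) carries over to ψ(φ⃗′) whenever φ⃗ and φ⃗′ realise the same truth-value profiles. The full model satisfies Cp ∨ Cp and p ∨ ¬p but neither
-- p ∨ p nor ¬p ∨ ¬p. If T(Cp) were contingent, a contingent T(p) would make T(Cp ∨ Cp) and
-- T(p ∨ p) indistinguishable, so T(p), and likewise T(¬p), would be unsatisfiable; but then
-- T(p ∨ ¬p) and T(p ∨ p) are indistinguishable. So every T(Cp) is unsatisfiable, which makes
-- T(C0 ∨ C0) and T(C0 ∨ C1) indistinguishable, although only the former holds in the full model.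
-- Truth of ℒ_D formulae is undecidable here, so the case splits are done under double negation,
-- which is harmless because satisfaction is ¬¬-stable.
module Submission where

open import Defs
open import Data.Bool using (Bool; true; false)
import Data.Bool as Bool
open import Data.Empty using (⊥)
open import Data.Fin using (Fin; zero; suc)
open import Data.List using ([]; _∷_)
open import Data.Nat using (ℕ; zero; suc)
open import Data.Product using (Σ; ∃-syntax; _×_; _,_)
open import Data.Sum using (_⊎_; inj₁; inj₂; [_,_])
open import Data.Unit using (⊤; tt)
open import Data.Vec using ([])
open import Effect.Monad using (RawMonad)
open import Function.Bundles using (_⇔_; mk⇔; Equivalence)
import Function.Properties.Equivalence as ⇔
open import Level using (lift)
import Level
open import Relation.Binary.PropositionalEquality using (_≡_; refl; sym; trans; subst)
open import Relation.Nullary using (¬_)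
open import Relation.Nullary.Decidable using (yes; no; decidable-stable; ¬¬-excluded-middle)
open import Relation.Nullary.Negation using (Stable; negated-stable; ¬¬-Monad; contradiction)

open Equivalence
open RawMonad (¬¬-Monad {Level.zero})

private
  variable
    n : ℕ
    W W' : SDModel
    σ σ' : Fin n → LForm
    u u' v v' : Assignment
    f g f' g' : LForm

inhabited-⇔ : ∀ {A B : Set} → A → B → A ⇔ B
inhabited-⇔ a b = mk⇔ (λ _ → b) (λ _ → a)

empty-⇔ : ∀ {A B : Set} → ¬ A → ¬ B → A ⇔ B
empty-⇔ ¬a ¬b = mk⇔ (λ a → contradiction a ¬a) (λ b → contradiction b ¬b)

⇔-stable : ∀ {A B : Set} → Stable A → Stable B → Stable (A ⇔ B)
⇔-stable stableA stableB ¬¬a⇔b =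
  mk⇔ (λ a → stableB λ ¬b → ¬¬a⇔b λ e → ¬b (to e a))
      (λ b → stableA λ ¬a → ¬¬a⇔b λ e → ¬a (from e b))

Sat-stable : ∀ W w φ → Stable (Sat W w φ)
Sat-stable W w (var p)           = decidable-stable (w p Bool.≟ true)
Sat-stable W w (neg φ)           = negated-stable
Sat-stable W w (imp φ ψ) ¬¬φ→ψ a = Sat-stable W w ψ λ ¬b → ¬¬φ→ψ λ φ→ψ → ¬b (φ→ψ a)
Sat-stable W w (depL φs ψ) ¬¬dependent u v Wu Wv agree =
  ⇔-stable (Sat-stable W u ψ) (Sat-stable W v ψ)
    λ ¬e → ¬¬dependent λ dependent → ¬e (dependent u v Wu Wv agree)

SameProfile : SDModel → (Fin n → LForm) → Assignment → SDModel → (Fin n → LForm) → Assignment → Set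
SameProfile W σ u W' σ' u' = ∀ i → Sat W u (σ i) ⇔ Sat W' u' (σ' i)

SameProfile-sym : SameProfile W σ u W' σ' u' → SameProfile W' σ' u' W σ u
SameProfile-sym same i = ⇔.sym (same i)

record ProfileMatch (W : SDModel) (σ : Fin n → LForm) (W' : SDModel) (σ' : Fin n → LForm) : Set where
  field
    forth : ∀ u → W u → ¬ ¬ (∃[ u' ] W' u' × SameProfile W σ u W' σ' u')
    back  : ∀ u' → W' u' → ¬ ¬ (∃[ u ] W u × SameProfile W σ u W' σ' u')

open ProfileMatch

ProfileMatch-sym : ProfileMatch W σ W' σ' → ProfileMatch W' σ' W σ
ProfileMatch-sym M = record
  { forth = λ u' W'u' → do (u , Wu , same) ← back M u' W'u'
                           pure (u , Wu , SameProfile-sym same)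
  ; back  = λ u Wu → do (u' , W'u' , same) ← forth M u Wu
                        pure (u' , W'u' , SameProfile-sym same)
  }

mutual
  inst-transfer : ProfileMatch W σ W' σ' → ∀ t →
                  SameProfile W σ u W' σ' u' → Sat W u (inst t σ) → Sat W' u' (inst t σ')
  inst-transfer M (X i)      same = to (same i)
  inst-transfer M (negO t)   same ¬s s′ =
    ¬s (inst-transfer (ProfileMatch-sym M) t (SameProfile-sym same) s′)
  inst-transfer M (impO t s) same t→s t′ =
    inst-transfer M s same (t→s (inst-transfer (ProfileMatch-sym M) t (SameProfile-sym same) t′))
  inst-transfer M (depO ts t) same dependent u' v' W'u' W'v' agree′ =
    ⇔-stable (Sat-stable _ u' _) (Sat-stable _ v' _) do
      (u , Wu , sameᵘ) ← back M u' W'u'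
      (v , Wv , sameᵛ) ← back M v' W'v'
      let agree = agree-transfer M ts sameᵘ sameᵛ agree′
      pure (⇔.trans (⇔.sym (inst-⇔ M t sameᵘ)) (⇔.trans (dependent u v Wu Wv agree) (inst-⇔ M t sameᵛ)))

  inst-⇔ : ProfileMatch W σ W' σ' → ∀ t →
           SameProfile W σ u W' σ' u' → Sat W u (inst t σ) ⇔ Sat W' u' (inst t σ')
  inst-⇔ M t same =
    mk⇔ (inst-transfer M t same) (inst-transfer (ProfileMatch-sym M) t (SameProfile-sym same))

  agree-transfer : ProfileMatch W σ W' σ' → ∀ ts →
                   SameProfile W σ u W' σ' u' → SameProfile W σ v W' σ' v' →
                   AgreeAll W' u' v' (instList ts σ') → AgreeAll W u v (instList ts σ)
  agree-transfer M []       sameᵘ sameᵛ _ = lift tt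
  agree-transfer M (s ∷ ts) sameᵘ sameᵛ (e , agree) =
    ⇔.trans (inst-⇔ M s sameᵘ) (⇔.trans e (⇔.sym (inst-⇔ M s sameᵛ))) ,
    agree-transfer M ts sameᵘ sameᵛ agree

⊨-transfer : ProfileMatch W σ W' σ' → ∀ t → W ⊨ inst t σ → W' ⊨ inst t σ'
⊨-transfer M t valid u' W'u' = Sat-stable _ u' _ do
  (u , Wu , same) ← back M u' W'u'
  pure (inst-transfer M t same (valid u Wu))

Full : SDModel
Full _ = ⊤

Satisfiable : LForm → Set
Satisfiable φ = ∃[ u ] Sat Full u φ

Contingent : LForm → Set
Contingent φ = ¬ ¬ Satisfiable φ × ¬ Full ⊨ φ

refutable : ∀ {φ} → ¬ Full ⊨ φ → ¬ ¬ (∃[ u ] ¬ Sat Full u φ)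
refutable {φ} ¬valid ¬refutable = ¬valid λ u _ → Sat-stable Full u φ λ ¬s → ¬refutable (u , ¬s)

contingent-matches : ∀ {φ} → Contingent φ → (A : Set) → ¬ ¬ (∃[ u ] (A ⇔ Sat Full u φ))
contingent-matches (satisfiable , ¬valid) A = ¬¬-excluded-middle >>= λ
  { (yes a) → do (u , s) ← satisfiable
                 pure (u , inhabited-⇔ a s)
  ; (no ¬a) → do (u , ¬s) ← refutable ¬valid
                 pure (u , empty-⇔ ¬a ¬s)
  }

pair-profile : (Sat W u f ⇔ Sat W' u' f') → (Sat W u g ⇔ Sat W' u' g') →
               SameProfile W (env2 f g) u W' (env2 f' g') u'
pair-profile e₁ e₂ zero       = e₁
pair-profile e₁ e₂ (suc zero) = e₂

unsatisfiable-match : ¬ Satisfiable f → ¬ Satisfiable g → ¬ Satisfiable f' → ¬ Satisfiable g' →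
                      ProfileMatch Full (env2 f g) Full (env2 f' g')
unsatisfiable-match ¬f ¬g ¬f' ¬g' = record
  { forth = λ u _ → pure (u , tt , same u)
  ; back  = λ u _ → pure (u , tt , same u)
  }
  where
    same : ∀ u → SameProfile Full (env2 _ _) u Full (env2 _ _) u
    same u = pair-profile (empty-⇔ (λ s → ¬f (u , s)) (λ s → ¬f' (u , s)))
                          (empty-⇔ (λ s → ¬g (u , s)) (λ s → ¬g' (u , s)))

contingent-match : Contingent f → Contingent g → ProfileMatch Full (env2 f f) Full (env2 g g)
contingent-match {f} {g} contingentᶠ contingentᵍ = record
  { forth = λ u _ → do (u' , e) ← contingent-matches contingentᵍ (Sat Full u f)
                       pure (u' , tt , pair-profile e e)
  ; back  = λ u' _ → do (u , e) ← contingent-matches contingentᶠ (Sat Full u' g)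
                        pure (u , tt , pair-profile (⇔.sym e) (⇔.sym e))
  }

C : ℕ → DForm
C q = dep 0 [] q

by-value : ∀ (b : Bool) → b ≡ true ⊎ b ≡ false
by-value true  = inj₁ refl
by-value false = inj₂ refl

full⊩Cp∨Cp : ∀ p → Full ⊩ (C p ∨ᴰ C p)
full⊩Cp∨Cp p =
  (λ w → w p ≡ true) , (λ w → w p ≡ false) , (λ _ _ → tt) , (λ _ _ → tt) ,
  (λ w _ → by-value (w p)) ,
  lift (λ _ _ pu pv _ → trans pu (sym pv)) ,
  lift (λ _ _ pu pv _ → trans pu (sym pv))

full⊩p∨¬p : ∀ p → Full ⊩ (atom p ∨ᴰ negAtom p)
full⊩p∨¬p p =
  (λ w → w p ≡ true) , (λ w → w p ≡ false) , (λ _ _ → tt) , (λ _ _ → tt) ,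
  (λ w _ → by-value (w p)) , lift (λ _ pw → pw) , lift (λ _ pw → pw)

full⊮p∨p : ∀ p → ¬ Full ⊩ (atom p ∨ᴰ atom p)
full⊮p∨p p (_ , _ , _ , _ , cover , lift onU , lift onV) =
  [ (λ inU → contradiction (onU _ inU) λ ()) , (λ inV → contradiction (onV _ inV) λ ()) ]
    (cover (λ _ → false) tt)

full⊮¬p∨¬p : ∀ p → ¬ Full ⊩ (negAtom p ∨ᴰ negAtom p)
full⊮¬p∨¬p p (_ , _ , _ , _ , cover , lift onU , lift onV) =
  [ (λ inU → contradiction (onU _ inU) λ ()) , (λ inV → contradiction (onV _ inV) λ ()) ]
    (cover (λ _ → true) tt)

full⊮Cp : ∀ p → ¬ Full ⊩ C p
full⊮Cp p (lift constant) = contradiction (constant (λ _ → true) (λ _ → false) tt tt λ ()) λ ()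

full⊮p : ∀ p → ¬ Full ⊩ atom p
full⊮p p (lift holds) = contradiction (holds (λ _ → false) tt) λ ()

full⊮¬p : ∀ p → ¬ Full ⊩ negAtom p
full⊮¬p p (lift holds) = contradiction (holds (λ _ → true) tt) λ ()

valuation : Bool → Bool → Assignment
valuation b₀ b₁ zero    = b₀
valuation b₀ b₁ (suc _) = b₁

full⊮C0∨C1 : ¬ Full ⊩ (C 0 ∨ᴰ C 1)
full⊮C0∨C1 (U , V , _ , _ , cover , lift constU , lift constV) =
  split (cover (valuation true true) tt) (cover (valuation false false) tt)
        (cover (valuation false true) tt) (cover (valuation true false) tt)
  where
    U-const : ∀ {x y} → U x → U y → x 0 ≡ y 0
    U-const Ux Uy = constU _ _ Ux Uy λ ()
    V-const : ∀ {x y} → V x → V y → x 1 ≡ y 1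
    V-const Vx Vy = constV _ _ Vx Vy λ ()
    Covered : Assignment → Set
    Covered w = U w ⊎ V w
    split : Covered (valuation true true) → Covered (valuation false false) →
            Covered (valuation false true) → Covered (valuation true false) → ⊥
    split (inj₁ U11) (inj₁ U00) _          _          = contradiction (U-const U11 U00) λ ()
    split (inj₂ V11) (inj₂ V00) _          _          = contradiction (V-const V11 V00) λ ()
    split (inj₁ U11) (inj₂ V00) (inj₁ U01) _          = contradiction (U-const U11 U01) λ ()
    split (inj₁ U11) (inj₂ V00) (inj₂ V01) _          = contradiction (V-const V01 V00) λ ()
    split (inj₂ V11) (inj₁ U00) _          (inj₁ U10) = contradiction (U-const U10 U00) λ ()
    split (inj₂ V11) (inj₁ U00) _          (inj₂ V10) = contradiction (V-const V11 V10) λ ()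

module _ (T : DForm → LForm) (ψ∨ : OpTerm 2)
         (T-∨ : ∀ φ ψ → T (φ ∨ᴰ ψ) ≡ inst ψ∨ (env2 (T φ) (T ψ)))
         (sound : Sound T) where

  ∨-transfer : ∀ {φ ψ φ' ψ'} → ProfileMatch Full (env2 (T φ) (T ψ)) Full (env2 (T φ') (T ψ')) →
               Full ⊩ (φ ∨ᴰ ψ) → Full ⊩ (φ' ∨ᴰ ψ')
  ∨-transfer {φ} {ψ} {φ'} {ψ'} M holds =
    from (sound Full (φ' ∨ᴰ ψ')) (subst (Full ⊨_) (sym (T-∨ φ' ψ'))
      (⊨-transfer M ψ∨ (subst (Full ⊨_) (T-∨ φ ψ) (to (sound Full (φ ∨ᴰ ψ)) holds))))

  T-not-valid : ∀ {φ} → ¬ Full ⊩ φ → ¬ Full ⊨ T φ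
  T-not-valid {φ} ¬holds valid = ¬holds (from (sound Full φ) valid)

  T-C-unsatisfiable : ∀ p → ¬ Satisfiable (T (C p))
  T-C-unsatisfiable p satisfiable =
    full⊮p∨p p (∨-transfer (unsatisfiable-match ¬p ¬¬p ¬p ¬p) (full⊩p∨¬p p))
    where
      C-contingent : Contingent (T (C p))
      C-contingent = pure satisfiable , T-not-valid (full⊮Cp p)

      unsatisfiable : ∀ {φ} → ¬ Full ⊩ φ → ¬ Full ⊩ (φ ∨ᴰ φ) → ¬ Satisfiable (T φ)
      unsatisfiable ¬φ ¬φ∨φ s =
        ¬φ∨φ (∨-transfer (contingent-match C-contingent (pure s , T-not-valid ¬φ)) (full⊩Cp∨Cp p))

      ¬p : ¬ Satisfiable (T (atom p))
      ¬p = unsatisfiable (full⊮p p) (full⊮p∨p p)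

      ¬¬p : ¬ Satisfiable (T (negAtom p))
      ¬¬p = unsatisfiable (full⊮¬p p) (full⊮¬p∨¬p p)

  no-sound-translation-with-compositional-∨ : ⊥
  no-sound-translation-with-compositional-∨ =
    full⊮C0∨C1 (∨-transfer (unsatisfiable-match ¬C0 ¬C0 ¬C0 (T-C-unsatisfiable 1)) (full⊩Cp∨Cp 0))
    where
      ¬C0 : ¬ Satisfiable (T (C 0))
      ¬C0 = T-C-unsatisfiable 0

theorem6p6 : ¬ (Σ (DForm → LForm) λ T → Compositional T × Sound T)
theorem6p6 (T , compositional , sound) =
  no-sound-translation-with-compositional-∨ T ψor orEq sound
  where open Compositional compositional
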